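{- Let $k\ge 1$. If $G$ is a $Tr_k^{(v,e)}$-critical graph, then $G$ is a $k$-atom, i.e. $G\in\mathcal{A}_k$.
   Context: All graphs are finite and simple. For disjoint $A,B\subseteq V$, $A$ dominates $B$ if every vertex of $B$ is adjacent to at least one vertex of $A$. A transitive $k$-partition of $G=(V,E)$ is a partition $\{V_1,\dots,V_k\}$ of $V$ into $k$ nonempty parts such that $V_i$ dominates $V_j$ for all $1\le i<j\le k$; the transitivity $Tr(G)$ is the maximum such $k$. A graph $G=(V,E)$ is transitively vertex-edge critical if deleting any element of $V\cup E$ (deleting a vertex removes it with its incident edges) yields a graph of transitivity less than $Tr(G)$; such a graph with $Tr(G)=k$ is $Tr_k^{(v,e)}$-critical. $t$-atoms are defined recursively: the only $1$-atom is $K_1$; if $H=(V,E)$ is a $(t-1)$-atom with $n$ vertices, choose $r\in\{1,\dots,n\}$, a set $I_r$ of $r$ new independent vertices and an $r$-subset $W\subseteq V$, add a perfect matching between $I_r$ and $W$, and join each vertex of $V\setminus W$ by an edge to exactly one (arbitrary) vertex of $I_r$; every graph so obtained is a $t$-atom. $\mathcal{A}_t$ denotes the set of $t$-atoms (up to isomorphism). -}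

module Defs where

open import Data.Nat using (ℕ; zero; suc; _+_; _≤_)
open import Data.Fin using (Fin; punchIn) renaming (_<_ to _<ᶠ_)
open import Data.Product using (Σ; ∃; _×_; _,_)
open import Data.Sum using (_⊎_)
open import Data.Empty using (⊥)
open import Relation.Nullary using (¬_)
open import Relation.Binary.PropositionalEquality using (_≡_; _≢_)
open import Function.Bundles using (_⇔_)
open import Level using (0ℓ)

record Graph : Set₁ where
  field
    n     : ℕ
    E     : Fin n → Fin n → Set
    sym   : ∀ {a b} → E a b → E b a
    irr   : ∀ a → ¬ E a a

open Graph public

removeVertex : ∀ m (E : Fin m → Fin m → Set) →
               (∀ {a b} → E a b → E b a) → (∀ a → ¬ E a a) → Fin m → Graph
removeVertex (suc m) E s i v = record
  { n = m
  ; E = λ a b → E (punchIn v a) (punchIn v b)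
  ; sym = s
  ; irr = λ a → i (punchIn v a) }

deleteVertex : (G : Graph) → Fin (n G) → Graph
deleteVertex G v = removeVertex (n G) (E G) (sym G) (irr G) v

deleteEdge : (G : Graph) → Fin (n G) → Fin (n G) → Graph
deleteEdge G u v = record
  { n = n G
  ; E = λ a b → E G a b × ¬ ((a ≡ u × b ≡ v) ⊎ (a ≡ v × b ≡ u))
  ; sym = λ { (e , ne) → sym G e , λ { (Data.Sum.inj₁ (p , q)) → ne (Data.Sum.inj₂ (q , p))
                                     ; (Data.Sum.inj₂ (p , q)) → ne (Data.Sum.inj₁ (q , p)) } }
  ; irr = λ a p → irr G a (Data.Product.proj₁ p) }

-- A transitive k-partition: f assigns each vertex its part V_{f x}; all k parts are nonempty,
-- and V_i dominates V_j whenever i < j.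
TransitivePartition : Graph → ℕ → Set
TransitivePartition G k =
  Σ (Fin (n G) → Fin k) λ f →
    (∀ i → ∃ λ x → f x ≡ i) ×
    (∀ i j → i <ᶠ j → ∀ y → f y ≡ j → ∃ λ x → f x ≡ i × E G x y)

TrIs : Graph → ℕ → Set
TrIs G k = TransitivePartition G k × (∀ m → TransitivePartition G m → m ≤ k)

TrBelow : Graph → ℕ → Set
TrBelow H k = ∀ m → TransitivePartition H m → suc m ≤ k

TrCritical : ℕ → Graph → Set
TrCritical k G =
  TrIs G k ×
  (∀ v → TrBelow (deleteVertex G v) k) ×
  (∀ u v → E G u v → TrBelow (deleteEdge G u v) k)

-- G arises from H by one atom-extension step (up to isomorphism):
-- the vertices of G are split (via injections old/new) into a copy of V(H) and a set I_r of r new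
-- vertices; W = image of μ (an r-subset of V(H)), the perfect matching is μ i — i,
-- and each vertex a ∉ W is joined to exactly the new vertex τ a.
record Extension (H G : Graph) : Set where
  field
    r       : ℕ
    r≥1     : 1 ≤ r
    r≤n     : r ≤ n H
    old     : Fin (n H) → Fin (n G)
    new     : Fin r → Fin (n G)
    old-inj : ∀ a b → old a ≡ old b → a ≡ b
    new-inj : ∀ i j → new i ≡ new j → i ≡ j
    disj    : ∀ a i → old a ≢ new i
    cover   : ∀ x → (∃ λ a → old a ≡ x) ⊎ (∃ λ i → new i ≡ x)
    μ       : Fin r → Fin (n H)
    μ-inj   : ∀ i j → μ i ≡ μ j → i ≡ j
    τ       : Fin (n H) → Fin r
    E-old   : ∀ a b → E G (old a) (old b) ⇔ E H a b
    E-new   : ∀ i j → ¬ E G (new i) (new j)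
    E-cross : ∀ a i → E G (old a) (new i) ⇔
                ((μ i ≡ a) ⊎ ((¬ ∃ λ j → μ j ≡ a) × τ a ≡ i))

-- t-atoms (closed under isomorphism: the 1-atom K₁ is any one-vertex graph,
-- and Extension is isomorphism-invariant in G).
data Atom : ℕ → Graph → Set₁ where
  atom₁  : ∀ G → n G ≡ 1 → Atom 1 G
  atomₛ  : ∀ {t} H G → Atom t H → Extension H G → Atom (suc t) G

-- Fix a transitive k-partition V₁, …, V_k of the critical graph G, k ≥ 2. Since V₁ dominates
-- everything else, any transitive partition of H = G − V₁ (also after deleting a vertex or an
-- edge of H) extends to G by putting V₁ in front; so H is Tr_{k−1}-critical and, by induction,
-- a (k−1)-atom. Edge-criticality forces V₁ to be independent and every vertex of H to have
-- exactly one neighbour τ(a) in V₁, since otherwise some edge could be deleted without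
-- destroying the partition. Vertex-criticality forces τ to be onto V₁, since otherwise a vertex
-- of V₁ could be deleted. Choosing a preimage μ(i) for each i ∈ V₁ gives the matching of the
-- atom construction, and the remaining vertices of H are joined to V₁ through τ alone.

module Submission where

open import Defs hiding (sym)
open import Data.Nat using (ℕ; zero; suc; _≤_; z≤n; s≤s; s≤s⁻¹; >-nonZero⁻¹)
open import Data.Nat.Properties using (n≮n; n≮0; ≤-antisym)
open import Data.Fin using (Fin; zero; suc; _≟_; punchIn; punchOut) renaming (_<_ to _<ᶠ_)
open import Data.Fin.Properties
  using (any?; injective⇒≤; nonZeroIndex; suc-injective; 0≢1+n; punchInᵢ≢i; punchIn-injective; punchIn-punchOut)
open import Data.Product using (∃; _×_; _,_; proj₁; proj₂)
open import Data.Sum using (_⊎_; inj₁; inj₂)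
open import Data.Empty using (⊥-elim)
open import Relation.Nullary using (¬_; yes; no)
open import Relation.Nullary.Decidable using (¬?; _×-dec_)
open import Relation.Unary using (Decidable)
open import Relation.Binary.PropositionalEquality using (_≡_; _≢_; refl; sym; trans; cong; subst; subst₂)
open import Function.Bundles using (mk⇔)

record Enumeration {n : ℕ} (P : Fin n → Set) : Set where
  field
    size         : ℕ
    at           : Fin size → Fin n
    at-injective : ∀ a b → at a ≡ at b → a ≡ b
    at-∈         : ∀ a → P (at a)
    at-onto      : ∀ x → P x → ∃ λ a → at a ≡ x

module _ {n : ℕ} {P : Fin (suc n) → Set} where

  enumeration-keep-zero : P zero → Enumeration (λ x → P (suc x)) → Enumeration P
  enumeration-keep-zero p V = record
    { size = suc size ; at = at′ ; at-injective = injective ; at-∈ = ∈ ; at-onto = onto }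
    where
    open Enumeration V
    at′ : Fin (suc size) → Fin (suc n)
    at′ zero    = zero
    at′ (suc a) = suc (at a)
    injective : ∀ a b → at′ a ≡ at′ b → a ≡ b
    injective zero    zero    _ = refl
    injective (suc a) (suc b) q = cong suc (at-injective a b (suc-injective q))
    ∈ : ∀ a → P (at′ a)
    ∈ zero    = p
    ∈ (suc a) = at-∈ a
    onto : ∀ x → P x → ∃ λ a → at′ a ≡ x
    onto zero    _  = zero , refl
    onto (suc x) px = suc (proj₁ (at-onto x px)) , cong suc (proj₂ (at-onto x px))

  enumeration-skip-zero : ¬ P zero → Enumeration (λ x → P (suc x)) → Enumeration P
  enumeration-skip-zero ¬p V = record
    { size = size ; at = λ a → suc (at a) ; at-injective = injective ; at-∈ = at-∈ ; at-onto = onto }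
    where
    open Enumeration V
    injective : ∀ a b → suc (at a) ≡ suc (at b) → a ≡ b
    injective a b q = at-injective a b (suc-injective q)
    onto : ∀ x → P x → ∃ λ a → suc (at a) ≡ x
    onto zero    px = ⊥-elim (¬p px)
    onto (suc x) px = proj₁ (at-onto x px) , cong suc (proj₂ (at-onto x px))

enumerate : ∀ {n} {P : Fin n → Set} → Decidable P → Enumeration P
enumerate {zero}  P? = record { size = 0 ; at = λ () ; at-injective = λ () ; at-∈ = λ () ; at-onto = λ () }
enumerate {suc n} P? with P? zero
... | yes p  = enumeration-keep-zero p  (enumerate (λ x → P? (suc x)))
... | no ¬p = enumeration-skip-zero ¬p (enumerate (λ x → P? (suc x)))

induced : (G : Graph) {P : Fin (n G) → Set} → Enumeration P → Graph
induced G V = record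
  { n = size ; E = λ a b → E G (at a) (at b) ; sym = Graph.sym G ; irr = λ a → irr G (at a) }
  where open Enumeration V

record VertexDeletion (G : Graph) (w : Fin (n G)) : Set where
  field
    ι           : Fin (n (deleteVertex G w)) → Fin (n G)
    ι-injective : ∀ a b → ι a ≡ ι b → a ≡ b
    ι-≢         : ∀ a → ι a ≢ w
    ι-onto      : ∀ x → x ≢ w → ∃ λ a → ι a ≡ x
    ι-edge      : ∀ {a b} → E (deleteVertex G w) a b → E G (ι a) (ι b)
    ι-edge⁻¹    : ∀ {a b} → E G (ι a) (ι b) → E (deleteVertex G w) a b

vertexDeletion : ∀ G w → VertexDeletion G w
vertexDeletion record { n = suc m } w = record
  { ι           = punchIn w
  ; ι-injective = punchIn-injective w
  ; ι-≢         = punchInᵢ≢i w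
  ; ι-onto      = λ x x≢w → punchOut (λ p → x≢w (sym p)) , punchIn-punchOut (λ p → x≢w (sym p))
  ; ι-edge      = λ e → e
  ; ι-edge⁻¹    = λ e → e
  }

record DominatingSplit (G H : Graph) : Set₁ where
  field
    S           : Fin (n G) → Set
    S?          : Decidable S
    φ           : Fin (n H) → Fin (n G)
    φ-injective : ∀ a b → φ a ≡ φ b → a ≡ b
    φ-∉S        : ∀ a → ¬ S (φ a)
    φ-onto      : ∀ x → ¬ S x → ∃ λ a → φ a ≡ x
    φ-edge      : ∀ {a b} → E H a b → E G (φ a) (φ b)
    S-nonempty  : ∃ S
    S-dominates : ∀ y → ¬ S y → ∃ λ x → S x × E G x y

complementSplit : (G : Graph) {S : Fin (n G) → Set} (S? : Decidable S) → ∃ S →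
                  (∀ y → ¬ S y → ∃ λ x → S x × E G x y) →
                  DominatingSplit G (induced G (enumerate (λ x → ¬? (S? x))))
complementSplit G S? S-nonempty S-dominates = record
  { S = _ ; S? = S? ; φ = at ; φ-injective = at-injective ; φ-∉S = at-∈ ; φ-onto = at-onto
  ; φ-edge = λ e → e ; S-nonempty = S-nonempty ; S-dominates = S-dominates }
  where open Enumeration (enumerate (λ x → ¬? (S? x)))

module _ {G H : Graph} (D : DominatingSplit G H) where
  open DominatingSplit D

  lift : ∀ {p} → TransitivePartition H p → TransitivePartition G (suc p)
  lift {p} (g , g-onto , g-dom) = f , f-onto , f-dom
    where
    f : Fin (n G) → Fin (suc p)
    f x with S? x
    ... | yes _   = zero
    ... | no x∉S = suc (g (proj₁ (φ-onto x x∉S)))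

    f-S : ∀ x → S x → f x ≡ zero
    f-S x x∈S with S? x
    ... | yes _   = refl
    ... | no x∉S = ⊥-elim (x∉S x∈S)

    f-φ : ∀ a → f (φ a) ≡ suc (g a)
    f-φ a with S? (φ a)
    ... | yes φa∈S = ⊥-elim (φ-∉S a φa∈S)
    ... | no φa∉S = cong (λ b → suc (g b)) (φ-injective _ _ (proj₂ (φ-onto (φ a) φa∉S)))

    f-suc : ∀ x j → f x ≡ suc j → ∃ λ a → φ a ≡ x × g a ≡ j
    f-suc x j fx with S? x
    ... | yes _   = ⊥-elim (0≢1+n fx)
    ... | no x∉S = proj₁ (φ-onto x x∉S) , proj₂ (φ-onto x x∉S) , suc-injective fx

    f-onto : ∀ i → ∃ λ x → f x ≡ i
    f-onto zero    = proj₁ S-nonempty , f-S _ (proj₂ S-nonempty)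
    f-onto (suc i) with g-onto i
    ... | a , ga = φ a , trans (f-φ a) (cong suc ga)

    f-dom : ∀ i j → i <ᶠ j → ∀ y → f y ≡ j → ∃ λ x → f x ≡ i × E G x y
    f-dom zero    (suc j) _   y fy with f-suc y j fy
    ... | a , refl , _ with S-dominates (φ a) (φ-∉S a)
    ... | x , x∈S , e = x , f-S x x∈S , e
    f-dom (suc i) (suc j) i<j y fy with f-suc y j fy
    ... | a , refl , ga with g-dom i j (s≤s⁻¹ i<j) a ga
    ... | b , gb , e = φ b , trans (f-φ b) (cong suc gb) , φ-edge e

  splitDeleteVertex : ∀ v → DominatingSplit (deleteVertex G (φ v)) (deleteVertex H v)
  splitDeleteVertex v = record
    { S = λ x → S (DG.ι x) ; S? = λ x → S? (DG.ι x) ; φ = ψ ; φ-injective = ψ-injective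
    ; φ-∉S = ψ-∉S ; φ-onto = ψ-onto ; φ-edge = ψ-edge
    ; S-nonempty = S-nonempty′ ; S-dominates = S-dominates′ }
    where
    module DG = VertexDeletion (vertexDeletion G (φ v))
    module DH = VertexDeletion (vertexDeletion H v)

    S-≢ : ∀ {x} → S x → x ≢ φ v
    S-≢ x∈S refl = φ-∉S v x∈S

    φι-≢ : ∀ a → φ (DH.ι a) ≢ φ v
    φι-≢ a q = DH.ι-≢ a (φ-injective _ _ q)

    ψ : Fin (n (deleteVertex H v)) → Fin (n (deleteVertex G (φ v)))
    ψ a = proj₁ (DG.ι-onto (φ (DH.ι a)) (φι-≢ a))

    ιψ : ∀ a → DG.ι (ψ a) ≡ φ (DH.ι a)
    ιψ a = proj₂ (DG.ι-onto (φ (DH.ι a)) (φι-≢ a))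

    ψ-injective : ∀ a b → ψ a ≡ ψ b → a ≡ b
    ψ-injective a b q =
      DH.ι-injective a b (φ-injective _ _ (trans (sym (ιψ a)) (trans (cong DG.ι q) (ιψ b))))

    ψ-∉S : ∀ a → ¬ S (DG.ι (ψ a))
    ψ-∉S a x∈S = φ-∉S (DH.ι a) (subst S (ιψ a) x∈S)

    ψ-onto : ∀ x → ¬ S (DG.ι x) → ∃ λ a → ψ a ≡ x
    ψ-onto x x∉S with φ-onto (DG.ι x) x∉S
    ... | c , φc with DH.ι-onto c (λ { refl → DG.ι-≢ x (sym φc) })
    ... | a , refl = a , DG.ι-injective _ _ (trans (ιψ a) φc)

    ψ-edge : ∀ {a b} → E (deleteVertex H v) a b → E (deleteVertex G (φ v)) (ψ a) (ψ b)
    ψ-edge {a} {b} e = DG.ι-edge⁻¹ (subst₂ (E G) (sym (ιψ a)) (sym (ιψ b)) (φ-edge (DH.ι-edge e)))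

    S-nonempty′ : ∃ λ x → S (DG.ι x)
    S-nonempty′ with DG.ι-onto (proj₁ S-nonempty) (S-≢ (proj₂ S-nonempty))
    ... | x , refl = x , proj₂ S-nonempty

    S-dominates′ : ∀ y → ¬ S (DG.ι y) → ∃ λ x → S (DG.ι x) × E (deleteVertex G (φ v)) x y
    S-dominates′ y y∉S with S-dominates (DG.ι y) y∉S
    ... | x , x∈S , e with DG.ι-onto x (S-≢ x∈S)
    ... | x′ , refl = x′ , x∈S , DG.ι-edge⁻¹ e

  splitDeleteEdge : ∀ u v → DominatingSplit (deleteEdge G (φ u) (φ v)) (deleteEdge H u v)
  splitDeleteEdge u v = record
    { S = S ; S? = S? ; φ = φ ; φ-injective = φ-injective ; φ-∉S = φ-∉S ; φ-onto = φ-onto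
    ; φ-edge = ψ-edge ; S-nonempty = S-nonempty ; S-dominates = S-dominates′ }
    where
    ψ-edge : ∀ {a b} → E (deleteEdge H u v) a b → E (deleteEdge G (φ u) (φ v)) (φ a) (φ b)
    ψ-edge (e , not-uv) = φ-edge e , λ
      { (inj₁ (p , q)) → not-uv (inj₁ (φ-injective _ _ p , φ-injective _ _ q))
      ; (inj₂ (p , q)) → not-uv (inj₂ (φ-injective _ _ p , φ-injective _ _ q)) }

    S-dominates′ : ∀ y → ¬ S y → ∃ λ x → S x × E (deleteEdge G (φ u) (φ v)) x y
    S-dominates′ y y∉S with S-dominates y y∉S
    ... | x , x∈S , e = x , x∈S , e , λ
      { (inj₁ (refl , _)) → φ-∉S u x∈S
      ; (inj₂ (refl , _)) → φ-∉S v x∈S }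

criticalSplit : ∀ {G H k} → DominatingSplit G H → TrCritical (suc k) G → TransitivePartition H k →
                TrCritical k H
criticalSplit D ((_ , maximal) , vertex-critical , edge-critical) P =
    (P , λ m Q → s≤s⁻¹ (maximal (suc m) (lift D Q)))
  , (λ v m Q → s≤s⁻¹ (vertex-critical (φ v) (suc m) (lift (splitDeleteVertex D v) Q)))
  , (λ u v e m Q → s≤s⁻¹ (edge-critical (φ u) (φ v) (φ-edge e) (suc m) (lift (splitDeleteEdge D u v) Q)))
  where open DominatingSplit D using (φ; φ-edge)

deleteVertexPartition : ∀ (G : Graph) {k} (w : Fin (n G)) (f : Fin (n G) → Fin k) →
                        (∀ i → ∃ λ x → x ≢ w × f x ≡ i) →
                        (∀ i j → i <ᶠ j → ∀ y → y ≢ w → f y ≡ j → ∃ λ x → x ≢ w × f x ≡ i × E G x y) →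
                        TransitivePartition (deleteVertex G w) k
deleteVertexPartition G w f parts dom = (λ a → f (ι a)) , onto , dom′
  where
  open VertexDeletion (vertexDeletion G w)
  onto : ∀ i → ∃ λ a → f (ι a) ≡ i
  onto i with parts i
  ... | x , x≢w , fx with ι-onto x x≢w
  ... | a , refl = a , fx
  dom′ : ∀ i j → i <ᶠ j → ∀ b → f (ι b) ≡ j → ∃ λ a → f (ι a) ≡ i × E (deleteVertex G w) a b
  dom′ i j i<j b fb with dom i j i<j (ι b) (ι-≢ b) fb
  ... | x , x≢w , fx , e with ι-onto x x≢w
  ... | a , refl = a , fx , ι-edge⁻¹ e

singletonPartition : (G : Graph) → Fin (n G) → TransitivePartition G 1
singletonPartition G x = (λ _ → zero) , (λ { zero → x , refl }) , λ { zero zero () }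

critical₁-singleton : ∀ {G} → TrCritical 1 G → n G ≡ 1
critical₁-singleton {G} ((P , _) , vertex-critical , _) =
  ≤-antisym (injective⇒≤ {f = λ _ → zero} (λ {x} {y} _ → all-equal x y)) (>-nonZero⁻¹ (n G) {{nonZeroIndex x₀}})
  where
  x₀ : Fin (n G)
  x₀ = proj₁ (proj₁ (proj₂ P) zero)
  all-equal : ∀ x y → x ≡ y
  all-equal x y with x ≟ y
  ... | yes x≡y = x≡y
  ... | no x≢y = ⊥-elim (n≮n 1 (vertex-critical x 1 (singletonPartition (deleteVertex G x) survivor)))
    where
    survivor : Fin (n (deleteVertex G x))
    survivor = proj₁ (VertexDeletion.ι-onto (vertexDeletion G x) y (λ p → x≢y (sym p)))

module CriticalStructure (k : ℕ) (G : Graph) (crit : TrCritical (suc (suc k)) G) where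

  f : Fin (n G) → Fin (suc (suc k))
  f = proj₁ (proj₁ (proj₁ crit))

  f-onto : ∀ i → ∃ λ x → f x ≡ i
  f-onto = proj₁ (proj₂ (proj₁ (proj₁ crit)))

  f-dom : ∀ i j → i <ᶠ j → ∀ y → f y ≡ j → ∃ λ x → f x ≡ i × E G x y
  f-dom = proj₂ (proj₂ (proj₁ (proj₁ crit)))

  ¬deleteVertexPartition : ∀ v → ¬ TransitivePartition (deleteVertex G v) (suc (suc k))
  ¬deleteVertexPartition v P = n≮n _ (proj₁ (proj₂ crit) v _ P)

  ¬deleteEdgePartition : ∀ {u v} → E G u v → ¬ TransitivePartition (deleteEdge G u v) (suc (suc k))
  ¬deleteEdgePartition {u} {v} e P = n≮n _ (proj₂ (proj₂ crit) u v e _ P)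

  V₁ : Fin (n G) → Set
  V₁ x = f x ≡ zero

  V₁? : Decidable V₁
  V₁? x = f x ≟ zero

  suc-∉V₁ : ∀ {x i} → f x ≡ suc i → ¬ V₁ x
  suc-∉V₁ fx x∈V₁ = 0≢1+n (trans (sym x∈V₁) fx)

  dominated-∉V₁ : ∀ {i j : Fin (suc (suc k))} {y} → i <ᶠ j → f y ≡ j → ¬ V₁ y
  dominated-∉V₁ {i} i<j fy y∈V₁ = n≮0 (subst (λ j → i <ᶠ j) (trans (sym fy) y∈V₁) i<j)

  V₁-dominates : ∀ y → ¬ V₁ y → ∃ λ x → V₁ x × E G x y
  V₁-dominates y y∉V₁ with f y in fy
  ... | zero  = ⊥-elim (y∉V₁ refl)
  ... | suc j = f-dom zero (suc j) (s≤s z≤n) y fy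

  V₁-independent : ∀ {x y} → V₁ x → V₁ y → ¬ E G x y
  V₁-independent {x} {y} x∈V₁ y∈V₁ e = ¬deleteEdgePartition e (f , f-onto , dom)
    where
    dom : ∀ i j → i <ᶠ j → ∀ y₀ → f y₀ ≡ j → ∃ λ x₀ → f x₀ ≡ i × E (deleteEdge G x y) x₀ y₀
    dom i j i<j y₀ fy₀ with f-dom i j i<j y₀ fy₀
    ... | x₀ , fx₀ , e₀ = x₀ , fx₀ , e₀ , λ
      { (inj₁ (_ , refl)) → dominated-∉V₁ i<j fy₀ y∈V₁
      ; (inj₂ (_ , refl)) → dominated-∉V₁ i<j fy₀ x∈V₁ }

  -- A second neighbour x′ ∈ V₁ of y can take over every domination that used the edge xy.
  V₁-neighbour-unique : ∀ {x x′ y} → V₁ x → V₁ x′ → E G x y → E G x′ y → x ≡ x′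
  V₁-neighbour-unique {x} {x′} {y} x∈V₁ x′∈V₁ e e′ with x ≟ x′
  ... | yes x≡x′ = x≡x′
  ... | no x≢x′ = ⊥-elim (¬deleteEdgePartition e (f , f-onto , dom))
    where
    dom : ∀ i j → i <ᶠ j → ∀ y₀ → f y₀ ≡ j → ∃ λ x₀ → f x₀ ≡ i × E (deleteEdge G x y) x₀ y₀
    dom i j i<j y₀ fy₀ with f-dom i j i<j y₀ fy₀
    ... | x₀ , fx₀ , e₀ with (x₀ ≟ x) ×-dec (y₀ ≟ y)
    ... | yes (refl , refl) = x′ , trans x′∈V₁ (trans (sym x∈V₁) fx₀) , e′ , λ
      { (inj₁ (x′≡x , _)) → x≢x′ (sym x′≡x)
      ; (inj₂ (_ , refl)) → dominated-∉V₁ i<j fy₀ x∈V₁ }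
    ... | no not-xy = x₀ , fx₀ , e₀ , λ
      { (inj₁ xy) → not-xy xy
      ; (inj₂ (_ , refl)) → dominated-∉V₁ i<j fy₀ x∈V₁ }

  module EV₁ = Enumeration (enumerate V₁?)
  module EH = Enumeration (enumerate (λ x → ¬? (V₁? x)))

  new : Fin EV₁.size → Fin (n G)
  new = EV₁.at

  old : Fin EH.size → Fin (n G)
  old = EH.at

  H : Graph
  H = induced G (enumerate (λ x → ¬? (V₁? x)))

  level : Fin (n H) → Fin (suc k)
  level a = punchOut (λ p → EH.at-∈ a (sym p))

  suc-level : ∀ a → suc (level a) ≡ f (old a)
  suc-level a = punchIn-punchOut {i = zero} _

  level-onto : ∀ i → ∃ λ a → level a ≡ i
  level-onto i with f-onto (suc i)
  ... | x , fx with EH.at-onto x (suc-∉V₁ fx)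
  ... | a , refl = a , suc-injective (trans (suc-level a) fx)

  level-dom : ∀ i j → i <ᶠ j → ∀ b → level b ≡ j → ∃ λ a → level a ≡ i × E H a b
  level-dom i j i<j b lb with f-dom (suc i) (suc j) (s≤s i<j) (old b) (trans (sym (suc-level b)) (cong suc lb))
  ... | x , fx , e with EH.at-onto x (suc-∉V₁ fx)
  ... | a , refl = a , suc-injective (trans (suc-level a) fx) , e

  H-critical : TrCritical (suc k) H
  H-critical = criticalSplit (complementSplit G V₁? (f-onto zero) V₁-dominates) crit
                             (level , level-onto , level-dom)

  τ : Fin (n H) → Fin EV₁.size
  τ a = proj₁ (EV₁.at-onto _ (proj₁ (proj₂ (V₁-dominates (old a) (EH.at-∈ a)))))

  τ-edge : ∀ a → E G (new (τ a)) (old a)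
  τ-edge a with V₁-dominates (old a) (EH.at-∈ a)
  ... | x , x∈V₁ , e = subst (λ z → E G z (old a)) (sym (proj₂ (EV₁.at-onto x x∈V₁))) e

  τ-unique : ∀ a i → E G (new i) (old a) → τ a ≡ i
  τ-unique a i e = EV₁.at-injective _ _ (V₁-neighbour-unique (EV₁.at-∈ (τ a)) (EV₁.at-∈ i) (τ-edge a) e)

  -- If no vertex outside V₁ has new i as its V₁-neighbour, the partition survives deleting new i.
  τ-onto : ∀ i → ∃ λ a → τ a ≡ i
  τ-onto i with any? (λ a → τ a ≟ i)
  ... | yes found = found
  ... | no none = ⊥-elim (¬deleteVertexPartition (new i) (deleteVertexPartition G (new i) f parts dom))
    where
    dominator-≢ : ∀ {x y} → ¬ V₁ y → E G x y → x ≢ new i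
    dominator-≢ y∉V₁ e refl with EH.at-onto _ y∉V₁
    ... | a , refl = none (a , τ-unique a i e)

    dom : ∀ i₀ j → i₀ <ᶠ j → ∀ y → y ≢ new i → f y ≡ j → ∃ λ x → x ≢ new i × f x ≡ i₀ × E G x y
    dom i₀ j i<j y _ fy with f-dom i₀ j i<j y fy
    ... | x , fx , e = x , dominator-≢ (dominated-∉V₁ i<j fy) e , fx , e

    new-i∉ : ∀ {x i₀} → f x ≡ suc i₀ → x ≢ new i
    new-i∉ fx refl = suc-∉V₁ fx (EV₁.at-∈ i)

    parts : ∀ i₀ → ∃ λ x → x ≢ new i × f x ≡ i₀
    parts zero with f-onto (suc zero)
    ... | y , fy with dom zero (suc zero) (s≤s z≤n) y (new-i∉ fy) fy
    ... | x , x≢ , fx , _ = x , x≢ , fx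
    parts (suc i₀) with f-onto (suc i₀)
    ... | x , fx = x , new-i∉ fx , fx

  μ : Fin EV₁.size → Fin (n H)
  μ i = proj₁ (τ-onto i)

  τ-μ : ∀ i → τ (μ i) ≡ i
  τ-μ i = proj₂ (τ-onto i)

  μ-injective : ∀ i j → μ i ≡ μ j → i ≡ j
  μ-injective i j q = trans (sym (τ-μ i)) (trans (cong τ q) (τ-μ j))

  edge-to-τ : ∀ a i → τ a ≡ i → E G (old a) (new i)
  edge-to-τ a _ refl = Graph.sym G (τ-edge a)

  cross-to : ∀ a i → E G (old a) (new i) → (μ i ≡ a) ⊎ ((¬ ∃ λ j → μ j ≡ a) × τ a ≡ i)
  cross-to a i e with any? (λ j → μ j ≟ a)
  ... | yes (j , refl) = inj₁ (cong μ (trans (sym (τ-unique (μ j) i (Graph.sym G e))) (τ-μ j)))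
  ... | no unmatched  = inj₂ (unmatched , τ-unique a i (Graph.sym G e))

  cross-from : ∀ a i → (μ i ≡ a) ⊎ ((¬ ∃ λ j → μ j ≡ a) × τ a ≡ i) → E G (old a) (new i)
  cross-from _ i (inj₁ refl)   = edge-to-τ (μ i) i (τ-μ i)
  cross-from a i (inj₂ (_ , t)) = edge-to-τ a i t

  extension : Extension H G
  extension = record
    { r       = EV₁.size
    ; r≥1     = >-nonZero⁻¹ EV₁.size {{nonZeroIndex (proj₁ (EV₁.at-onto _ (proj₂ (f-onto zero))))}}
    ; r≤n     = injective⇒≤ (λ {i} {j} → μ-injective i j)
    ; old     = old
    ; new     = new
    ; old-inj = EH.at-injective
    ; new-inj = EV₁.at-injective
    ; disj    = λ a i q → EH.at-∈ a (subst V₁ (sym q) (EV₁.at-∈ i))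
    ; cover   = cover
    ; μ       = μ
    ; μ-inj   = μ-injective
    ; τ       = τ
    ; E-old   = λ a b → mk⇔ (λ e → e) (λ e → e)
    ; E-new   = λ i j → V₁-independent (EV₁.at-∈ i) (EV₁.at-∈ j)
    ; E-cross = λ a i → mk⇔ (cross-to a i) (cross-from a i)
    }
    where
    cover : ∀ x → (∃ λ a → old a ≡ x) ⊎ (∃ λ i → new i ≡ x)
    cover x with V₁? x
    ... | yes x∈V₁ = inj₂ (EV₁.at-onto x x∈V₁)
    ... | no x∉V₁  = inj₁ (EH.at-onto x x∉V₁)

lemma4 : ∀ (k : ℕ) → 1 ≤ k → ∀ (G : Graph) → TrCritical k G → Atom k G
lemma4 1               _ G crit = atom₁ G (critical₁-singleton crit)
lemma4 (suc (suc k)) _ G crit = atomₛ H G (lemma4 (suc k) (s≤s z≤n) H H-critical) extension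
  where open CriticalStructure k G crit
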